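{- If $\Gamma_{\mathbf{a},\mathbf{s}}$ is a vertical-strip graph, with $\epsilon$ being a non-strict outer corner, then \begin{align*} \mathrm{L}_{\mathbf{a}\cup\{\epsilon\},\mathbf{s}}(\mathbf{x};q+1)= q\mathrm{L}_{\mathbf{a}, \mathbf{s} \cup \{\epsilon\}}(\mathbf{x};q+1)+ \mathrm{L}_{\mathbf{a},\mathbf{s}}(\mathbf{x};q+1). \end{align*}
   Context: An area sequence is $\mathbf{a}=(a_1,\dotsc,a_n)$ with $0\le a_i\le i-1$ and $a_{i+1}\le a_i+1$; $\Gamma_\mathbf{a}$ has vertex set $[n]$ and directed edges $j\to i$ for $i-a_i\le j\le i-1$. An outer corner $(u,v)$, $u<v$, is a non-edge with $u+1=v$ or with $(u+1,v)$, $(u,v-1)$ both edges; a vertical strip graph $\Gamma_{\mathbf{a},\mathbf{s}}$ is $\Gamma_\mathbf{a}$ plus a set $\mathbf{s}$ of outer corners (strict edges, oriented $u\to v$). $O(\mathbf{a},\mathbf{s})$ is the set of orientations of the undirected graph $\Gamma_\mathbf{a}$, together with the fixed directed strict edges. An edge of $\Gamma_\mathbf{a}$ is ascending in $\theta$ if oriented as in $\Gamma_\mathbf{a}$ (from smaller to larger vertex); strict edges are not ascending; $\mathrm{asc}(\theta)$ is the number of ascending edges. $\mathrm{hrv}_\theta(u)$ is the maximal $v$ reachable from $u$ by a directed path in $\theta$ using only strict and ascending edges; vertices with equal $\mathrm{hrv}_\theta$ form the blocks of a set partition of $[n]$, and $\pi(\theta)$ is the integer partition of block sizes. Define $\mathrm{L}_{\mathbf{a},\mathbf{s}}$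 by $\mathrm{L}_{\mathbf{a},\mathbf{s}}(\mathbf{x};q+1)=\sum_{\theta\in O(\mathbf{a},\mathbf{s})}q^{\mathrm{asc}(\theta)}\mathrm{e}_{\pi(\theta)}(\mathbf{x})$. $\mathbf{a}\cup\{\epsilon\}$ is the area sequence of $\Gamma_\mathbf{a}$ with edge $\epsilon$ added, and $\mathbf{s}\cup\{\epsilon\}$ adds $\epsilon$ to the strict edges. -}

module Defs where

open import Data.Nat using (ℕ; zero; suc; _∸_; _≤_; _<_; _⊔_; _≟_; _≤?_; _<?_)
open import Data.Bool using (Bool; true; false)
open import Data.List using (List; []; _∷_; map; length; upTo; filter; concatMap; zip; foldr)
open import Data.Product using (_×_; _,_; proj₁; proj₂)
open import Data.Sum using (_⊎_)
open import Relation.Binary.PropositionalEquality using (_≡_)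
open import Relation.Nullary using (¬_; Dec)
open import Relation.Nullary.Decidable using (_×-dec_)

-- Conventions: vertices of Γ_a are 0-based, i.e. vertex i ∈ {0,…,n-1} here
-- is vertex i+1 of the paper, and a ! i is the paper's a_{i+1}.
-- An area sequence is a list a with n = length a.

_!_ : List ℕ → ℕ → ℕ
[] ! _ = 0
(x ∷ xs) ! zero = x
(x ∷ xs) ! suc i = xs ! i

record IsAreaSeq (a : List ℕ) : Set where
  field
    bounded : ∀ i → i < length a → a ! i ≤ i
    step    : ∀ i → suc i < length a → a ! suc i ≤ suc (a ! i)

Edge : List ℕ → ℕ → ℕ → Set
Edge a j i = j < i × i < length a × (i ∸ (a ! i)) ≤ j

Edge? : (a : List ℕ) → ∀ j i → Dec (Edge a j i)
Edge? a j i = (j <? i) ×-dec ((i <? length a) ×-dec ((i ∸ (a ! i)) ≤? j))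

IsOuterCorner : List ℕ → ℕ × ℕ → Set
IsOuterCorner a (u , v) =
  u < v × v < length a × ¬ Edge a u v ×
  (suc u ≡ v ⊎ (Edge a (suc u) v × Edge a u (v ∸ 1)))

edges : List ℕ → List (ℕ × ℕ)
edges a = filter (λ e → Edge? a (proj₁ e) (proj₂ e))
            (concatMap (λ i → map (λ j → (j , i)) (upTo i)) (upTo (length a)))

allBools : ℕ → List (List Bool)
allBools zero = [] ∷ []
allBools (suc m) = concatMap (λ bs → (true ∷ bs) ∷ (false ∷ bs) ∷ []) (allBools m)

-- An orientation θ ∈ O(a,s) is encoded by a Boolean per edge of Γ_a
-- (in the order of 'edges a'): true = ascending (j → i), false = descending.
-- The strict edges s are fixed (never ascending).
orientations : List ℕ → List (List Bool)
orientations a = allBools (length (edges a))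

asc : List Bool → ℕ
asc [] = 0
asc (true ∷ bs) = suc (asc bs)
asc (false ∷ bs) = asc bs

ascEdges : List (ℕ × ℕ) → List Bool → List (ℕ × ℕ)
ascEdges (e ∷ es) (true ∷ bs) = e ∷ ascEdges es bs
ascEdges (e ∷ es) (false ∷ bs) = ascEdges es bs
ascEdges _ _ = []

hrvF : ℕ → List (ℕ × ℕ) → ℕ → ℕ
hrvF zero D u = u
hrvF (suc f) D u =
  foldr _⊔_ u (map (λ e → hrvF f D (proj₂ e)) (filter (λ e → proj₁ e ≟ u) D))

-- hrv_θ(u): D = strict edges ++ ascending edges; all vertices are < n, so
-- paths of length ≤ n suffice (any reachable vertex is reachable by a simple path).
hrv : List ℕ → List (ℕ × ℕ) → List Bool → ℕ → ℕ
hrv a s θ u = hrvF (length a) (s Data.List.++ ascEdges (edges a) θ) u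

blockSize : List ℕ → List (ℕ × ℕ) → List Bool → ℕ → ℕ
blockSize a s θ h = length (filter (λ u → hrv a s θ u ≟ h) (upTo (length a)))

-- π(θ), encoded by multiplicities: the k-th entry (k = 0,…,n-1) is the
-- number of blocks of size k+1.  This determines the integer partition uniquely.
partitionOf : List ℕ → List (ℕ × ℕ) → List Bool → List ℕ
partitionOf a s θ =
  map (λ k → length (filter (λ h → blockSize a s θ h ≟ suc k) (upTo (length a))))
      (upTo (length a))

-- L_{a,s}(x;q+1) = Σ_θ q^{asc θ} e_{π(θ)}, represented as the multiset (list)
-- of its monomials q^{asc θ} e_{π θ}, one per orientation θ ∈ O(a,s).
L : List ℕ → List (ℕ × ℕ) → List (ℕ × List ℕ)
L a s = map (λ θ → (asc θ , partitionOf a s θ)) (orientations a)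

timesQ : List (ℕ × List ℕ) → List (ℕ × List ℕ)
timesQ = map (λ t → (suc (proj₁ t) , proj₂ t))

module Submission where

-- Adding the non-strict outer corner ε = (u , v) to Γ_a adds exactly one edge,
-- so the edge list of Γ_{a∪ε} is that of Γ_a with ε inserted at some position k,
-- and every orientation of Γ_{a∪ε} is an orientation θ of Γ_a with one Boolean
-- inserted at position k.  If the new edge is descending, θ has the same ascents
-- and the same ascending edges, giving the term of L_{a,s}.  If it is ascending,
-- there is one more ascent and the directed graph of strict-or-ascending edges is
-- a permutation of the one of θ viewed in Γ_{a,s∪ε}, giving the term of
-- q·L_{a,s∪ε}.  Since hrv, hence π(θ), only depends on the edge list up to
-- permutation, the two families of terms are exactly the two sums on the right.

open import Defs
open import Data.Nat using (ℕ; zero; suc; _⊔_; _≟_; _<_; _≤_; s≤s)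
open import Data.Nat.Properties using (≤-trans; ≤-reflexive; ⊔-commutativeSemigroup)
open import Algebra.Properties.CommutativeSemigroup ⊔-commutativeSemigroup using (x∙yz≈y∙xz)
open import Data.Bool using (Bool; true; false)
open import Data.List using (List; []; _∷_; _++_; length; map; filter; foldr; concatMap; upTo)
open import Data.List.Properties
  using (map-cong; map-cong-local; map-∘; map-++; filter-≐; filter-accept; filter-reject;
         concatMap-++; length-++-sucʳ; length-++-≤ˡ)
open import Data.List.Relation.Unary.All using (All; []; _∷_)
import Data.List.Relation.Unary.All as All
import Data.List.Relation.Unary.All.Properties as AllP
open import Data.List.Relation.Unary.Any using (here; there)
import Data.List.Relation.Unary.Any as Any
import Data.List.Relation.Unary.AllPairs as AllPairs
import Data.List.Relation.Unary.AllPairs.Properties as AllPairsP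
open import Data.List.Relation.Unary.Unique.Propositional using (Unique)
import Data.List.Relation.Unary.Unique.Propositional.Properties as UniqueP
open import Data.List.Relation.Binary.Disjoint.Propositional using (Disjoint)
open import Data.List.Membership.Propositional using (_∈_; _∉_)
open import Data.List.Membership.Propositional.Properties
  using (∈-concatMap⁺; ∈-upTo⁺; ∈-map⁺; ∈-map⁻)
open import Data.List.Relation.Binary.Permutation.Propositional
  using (_↭_; refl; prep; swap; trans; ↭-sym; ↭-trans; ↭-reflexive; module PermutationReasoning)
open import Data.List.Relation.Binary.Permutation.Propositional.Properties
  using (shift; shifts; ++⁺ˡ; map⁺; filter-↭)
open import Data.Product using (_×_; _,_; proj₁; proj₂; ∃₂)
open import Data.Sum using (_⊎_; inj₁; inj₂)
open import Data.Empty using (⊥-elim)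
open import Function using (_∘_)
open import Function.Bundles using (_⇔_; mk⇔; Equivalence)
open import Relation.Nullary using (¬_; yes; no)
open import Relation.Unary using (Decidable)
open import Relation.Binary.PropositionalEquality
  using (_≡_; _≢_; refl; sym; cong; cong₂; module ≡-Reasoning)
import Relation.Binary.PropositionalEquality as Eq

EdgeList : Set
EdgeList = List (ℕ × ℕ)

foldr-⊔-↭ : ∀ u {xs ys : List ℕ} → xs ↭ ys → foldr _⊔_ u xs ≡ foldr _⊔_ u ys
foldr-⊔-↭ u refl = refl
foldr-⊔-↭ u (prep x p) = cong (x ⊔_) (foldr-⊔-↭ u p)
foldr-⊔-↭ u (swap {xs} x y p) =
  Eq.trans (x∙yz≈y∙xz x y (foldr _⊔_ u xs)) (cong (λ z → y ⊔ (x ⊔ z)) (foldr-⊔-↭ u p))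
foldr-⊔-↭ u (trans p q) = Eq.trans (foldr-⊔-↭ u p) (foldr-⊔-↭ u q)

hrvF-↭ : ∀ f {D D' : EdgeList} → D ↭ D' → ∀ u → hrvF f D u ≡ hrvF f D' u
hrvF-↭ zero p u = refl
hrvF-↭ (suc f) {D} {D'} p u = Eq.trans
  (cong (foldr _⊔_ u) (map-cong (λ e → hrvF-↭ f p (proj₂ e)) (filter (λ e → proj₁ e ≟ u) D)))
  (foldr-⊔-↭ u (map⁺ (λ e → hrvF f D' (proj₂ e)) (filter-↭ (λ e → proj₁ e ≟ u) p)))

colourClass : (ℕ → ℕ) → ℕ → List ℕ → List ℕ
colourClass c h = filter (λ x → c x ≟ h)

colourClass-cong : ∀ {c d : ℕ → ℕ} → (∀ x → c x ≡ d x) → ∀ h xs → colourClass c h xs ≡ colourClass d h xs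
colourClass-cong {c} {d} c≗d h =
  filter-≐ (λ x → c x ≟ h) (λ x → d x ≟ h) ((λ {x} eq → Eq.trans (sym (c≗d x)) eq) , (λ {x} eq → Eq.trans (c≗d x) eq))

-- The type of a colouring c of {0,…,n-1}: the k-th entry counts the colours
-- whose class has size k+1.  partitionOf a s θ is the type of hrv a s θ.
classSize : ℕ → (ℕ → ℕ) → ℕ → ℕ
classSize n c h = length (colourClass c h (upTo n))

colourType : ℕ → (ℕ → ℕ) → List ℕ
colourType n c = map (λ k → length (colourClass (classSize n c) (suc k) (upTo n))) (upTo n)

colourType-cong : ∀ n {c d : ℕ → ℕ} → (∀ x → c x ≡ d x) → colourType n c ≡ colourType n d
colourType-cong n {c} {d} c≗d = map-cong (λ k → cong length (colourClass-cong sameSizes (suc k) (upTo n))) (upTo n)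
  where
  sameSizes : ∀ h → classSize n c h ≡ classSize n d h
  sameSizes h = cong length (colourClass-cong c≗d h (upTo n))

partitionOf-↭ : ∀ a a' s s' θ θ' → length a' ≡ length a →
  s' ++ ascEdges (edges a') θ' ↭ s ++ ascEdges (edges a) θ →
  partitionOf a' s' θ' ≡ partitionOf a s θ
partitionOf-↭ a a' s s' θ θ' lenA D'↭D = begin
  colourType (length a') (hrvF (length a') D')
    ≡⟨ cong (λ n → colourType n (hrvF n D')) lenA ⟩
  colourType (length a) (hrvF (length a) D')
    ≡⟨ colourType-cong (length a) (hrvF-↭ (length a) D'↭D) ⟩
  colourType (length a) (hrvF (length a) (s ++ ascEdges (edges a) θ))
    ∎
  where
  open ≡-Reasoning
  D' = s' ++ ascEdges (edges a') θ'

insertAt : ℕ → Bool → List Bool → List Bool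
insertAt zero b θ = b ∷ θ
insertAt (suc k) b [] = b ∷ []
insertAt (suc k) b (x ∷ θ) = x ∷ insertAt k b θ

bothHeads : List Bool → List (List Bool)
bothHeads θ = (true ∷ θ) ∷ (false ∷ θ) ∷ []

concatMap-↭ : ∀ {A B : Set} (f : A → List B) {xs ys} → xs ↭ ys → concatMap f xs ↭ concatMap f ys
concatMap-↭ f refl = refl
concatMap-↭ f (prep x p) = ++⁺ˡ (f x) (concatMap-↭ f p)
concatMap-↭ f (swap x y p) = ↭-trans (shifts (f x) (f y)) (++⁺ˡ (f y) (++⁺ˡ (f x) (concatMap-↭ f p)))
concatMap-↭ f (trans p q) = ↭-trans (concatMap-↭ f p) (concatMap-↭ f q)

bothHeads-split : ∀ X → concatMap bothHeads X ↭ map (true ∷_) X ++ map (false ∷_) X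
bothHeads-split [] = refl
bothHeads-split (θ ∷ X) = prep (true ∷ θ) (↭-trans (prep (false ∷ θ) (bothHeads-split X))
  (↭-sym (shift (false ∷ θ) (map (true ∷_) X) (map (false ∷_) X))))

bothHeads-insertAt : ∀ k b X →
  concatMap bothHeads (map (insertAt k b) X) ≡ map (insertAt (suc k) b) (concatMap bothHeads X)
bothHeads-insertAt k b [] = refl
bothHeads-insertAt k b (θ ∷ X) = cong (λ Y → _ ∷ _ ∷ Y) (bothHeads-insertAt k b X)

allBools-insertAt : ∀ k m → allBools (suc m) ↭
  map (insertAt k true) (allBools m) ++ map (insertAt k false) (allBools m)
allBools-insertAt zero m = bothHeads-split (allBools m)
allBools-insertAt (suc k) zero = refl
allBools-insertAt (suc k) (suc m) = begin
  concatMap bothHeads (allBools (suc m))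
    ↭⟨ concatMap-↭ bothHeads (allBools-insertAt k m) ⟩
  concatMap bothHeads (map (insertAt k true) X ++ map (insertAt k false) X)
    ≡⟨ concatMap-++ bothHeads (map (insertAt k true) X) (map (insertAt k false) X) ⟩
  concatMap bothHeads (map (insertAt k true) X) ++ concatMap bothHeads (map (insertAt k false) X)
    ≡⟨ cong₂ _++_ (bothHeads-insertAt k true X) (bothHeads-insertAt k false X) ⟩
  map (insertAt (suc k) true) (allBools (suc m)) ++ map (insertAt (suc k) false) (allBools (suc m))
    ∎
  where
  open PermutationReasoning
  X = allBools m

allBools-length : ∀ m → All (λ θ → length θ ≡ m) (allBools m)
allBools-length zero = refl ∷ []
allBools-length (suc m) = heads (allBools m) (allBools-length m)
  where
  heads : ∀ X → All (λ θ → length θ ≡ m) X → All (λ θ → length θ ≡ suc m) (concatMap bothHeads X)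
  heads [] [] = []
  heads (θ ∷ X) (eq ∷ eqs) = cong suc eq ∷ cong suc eq ∷ heads X eqs

asc-insert-true : ∀ k θ → asc (insertAt k true θ) ≡ suc (asc θ)
asc-insert-true zero θ = refl
asc-insert-true (suc k) [] = refl
asc-insert-true (suc k) (true ∷ θ) = cong suc (asc-insert-true k θ)
asc-insert-true (suc k) (false ∷ θ) = asc-insert-true k θ

asc-insert-false : ∀ k θ → asc (insertAt k false θ) ≡ asc θ
asc-insert-false zero θ = refl
asc-insert-false (suc k) [] = refl
asc-insert-false (suc k) (true ∷ θ) = cong suc (asc-insert-false k θ)
asc-insert-false (suc k) (false ∷ θ) = asc-insert-false k θ

ascEdges-insert-true : ∀ (E₁ E₂ : EdgeList) c θ → length E₁ ≤ length θ →
  ascEdges (E₁ ++ c ∷ E₂) (insertAt (length E₁) true θ) ↭ c ∷ ascEdges (E₁ ++ E₂) θ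
ascEdges-insert-true [] E₂ c θ _ = refl
ascEdges-insert-true (e ∷ E₁) E₂ c (true ∷ θ) (s≤s k≤) =
  ↭-trans (prep e (ascEdges-insert-true E₁ E₂ c θ k≤)) (swap e c refl)
ascEdges-insert-true (e ∷ E₁) E₂ c (false ∷ θ) (s≤s k≤) = ascEdges-insert-true E₁ E₂ c θ k≤

ascEdges-insert-false : ∀ (E₁ E₂ : EdgeList) c θ → length E₁ ≤ length θ →
  ascEdges (E₁ ++ c ∷ E₂) (insertAt (length E₁) false θ) ≡ ascEdges (E₁ ++ E₂) θ
ascEdges-insert-false [] E₂ c θ _ = refl
ascEdges-insert-false (e ∷ E₁) E₂ c (true ∷ θ) (s≤s k≤) = cong (e ∷_) (ascEdges-insert-false E₁ E₂ c θ k≤)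
ascEdges-insert-false (e ∷ E₁) E₂ c (false ∷ θ) (s≤s k≤) = ascEdges-insert-false E₁ E₂ c θ k≤

module FilterInsert {A : Set} {P P' : A → Set} (P? : Decidable P) (P'? : Decidable P')
  {c : A} (P'c : P' c) (¬Pc : ¬ P c) (agree : ∀ {x} → x ≢ c → P' x ⇔ P x) where

  head-≢ : ∀ {x xs} → c ∉ x ∷ xs → x ≢ c
  head-≢ c∉ x≡c = c∉ (here (sym x≡c))

  filter-away : ∀ {xs} → c ∉ xs → filter P'? xs ≡ filter P? xs
  filter-away {[]} _ = refl
  filter-away {x ∷ xs} c∉ with P? x
  ... | yes px = Eq.trans (filter-accept P'? (Equivalence.from (agree (head-≢ c∉)) px))
                          (cong (x ∷_) (filter-away (c∉ ∘ there)))
  ... | no ¬px = Eq.trans (filter-reject P'? (¬px ∘ Equivalence.to (agree (head-≢ c∉))))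
                          (filter-away (c∉ ∘ there))

  filter-insert : ∀ {xs} → Unique xs → c ∈ xs →
    ∃₂ λ E₁ E₂ → filter P? xs ≡ E₁ ++ E₂ × filter P'? xs ≡ E₁ ++ c ∷ E₂
  filter-insert {c ∷ xs} uniq (here refl) =
    [] , filter P? xs , filter-reject P? ¬Pc ,
    Eq.trans (filter-accept P'? P'c) (cong (c ∷_) (filter-away (UniqueP.Unique[x∷xs]⇒x∉xs uniq)))
  filter-insert {x ∷ xs} (x≢xs AllPairs.∷ uniq) (there c∈xs)
    with filter-insert uniq c∈xs | P? x
  ... | E₁ , E₂ , eq , eq' | yes px =
    x ∷ E₁ , E₂ , cong (x ∷_) eq ,
    Eq.trans (filter-accept P'? (Equivalence.from (agree x≢c) px)) (cong (x ∷_) eq')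
    where x≢c = All.lookup x≢xs c∈xs
  ... | E₁ , E₂ , eq , eq' | no ¬px =
    E₁ , E₂ , eq ,
    Eq.trans (filter-reject P'? (¬px ∘ Equivalence.to (agree x≢c))) eq'
    where x≢c = All.lookup x≢xs c∈xs

column : ℕ → EdgeList
column i = map (λ j → (j , i)) (upTo i)

candidatePairs : ℕ → EdgeList
candidatePairs n = concatMap column (upTo n)

candidatePairs-unique : ∀ n → Unique (candidatePairs n)
candidatePairs-unique n =
  UniqueP.concat⁺ (AllP.map⁺ (All.tabulate (λ {i} _ → UniqueP.map⁺ (cong proj₁) (UniqueP.upTo⁺ i))))
                  (AllPairsP.map⁺ (AllPairs.map columns-disjoint (UniqueP.upTo⁺ n)))
  where
  columns-disjoint : ∀ {i i'} → i ≢ i' → Disjoint (column i) (column i')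
  columns-disjoint i≢i' (p , q) with ∈-map⁻ (λ j → (j , _)) p | ∈-map⁻ (λ j → (j , _)) q
  ... | _ , _ , refl | _ , _ , eq = i≢i' (cong proj₂ eq)

candidatePairs-∋ : ∀ {u v n} → u < v → v < n → (u , v) ∈ candidatePairs n
candidatePairs-∋ {u} {v} u<v v<n =
  ∈-concatMap⁺ column (Any.map (λ { refl → ∈-map⁺ (λ j → (j , v)) (∈-upTo⁺ u<v) }) (∈-upTo⁺ v<n))

edges-insert : ∀ a a' {u v} → length a' ≡ length a → IsOuterCorner a (u , v) →
  (∀ j i → Edge a' j i ⇔ (Edge a j i ⊎ (j ≡ u × i ≡ v))) →
  ∃₂ λ (E₁ E₂ : EdgeList) → edges a ≡ E₁ ++ E₂ × edges a' ≡ E₁ ++ (u , v) ∷ E₂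
edges-insert a a' {u} {v} lenA (u<v , v<n , ¬uv , _) iff =
  sameVertices (filter-insert (candidatePairs-unique (length a)) (candidatePairs-∋ u<v v<n))
  where
  isEdge : ∀ b → Decidable (λ (e : ℕ × ℕ) → Edge b (proj₁ e) (proj₂ e))
  isEdge b e = Edge? b (proj₁ e) (proj₂ e)
  agree : ∀ {e} → e ≢ (u , v) → Edge a' (proj₁ e) (proj₂ e) ⇔ Edge a (proj₁ e) (proj₂ e)
  agree {j , i} e≢uv = mk⇔ old (λ e → Equivalence.from (iff j i) (inj₁ e))
    where
    old : Edge a' j i → Edge a j i
    old e' with Equivalence.to (iff j i) e'
    ... | inj₁ e = e
    ... | inj₂ (refl , refl) = ⊥-elim (e≢uv refl)
  open FilterInsert (isEdge a) (isEdge a') (Equivalence.from (iff u v) (inj₂ (refl , refl))) ¬uv agree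
  sameVertices : (∃₂ λ E₁ E₂ → edges a ≡ E₁ ++ E₂ ×
                   filter (isEdge a') (candidatePairs (length a)) ≡ E₁ ++ (u , v) ∷ E₂) →
                 ∃₂ λ (E₁ E₂ : EdgeList) → edges a ≡ E₁ ++ E₂ × edges a' ≡ E₁ ++ (u , v) ∷ E₂
  sameVertices (E₁ , E₂ , eq , eq') =
    E₁ , E₂ , eq , Eq.trans (cong (λ n → filter (isEdge a') (candidatePairs n)) lenA) eq'

term : List ℕ → EdgeList → List Bool → ℕ × List ℕ
term a s θ = (asc θ , partitionOf a s θ)

timesQTerm : ℕ × List ℕ → ℕ × List ℕ
timesQTerm (d , π) = (suc d , π)

module EdgeInsertion (a a' : List ℕ) (s : EdgeList) (c : ℕ × ℕ) (E₁ E₂ : EdgeList)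
  (lenA : length a' ≡ length a) (eqE : edges a ≡ E₁ ++ E₂) (eqE' : edges a' ≡ E₁ ++ c ∷ E₂) where

  k m : ℕ
  k = length E₁
  m = length (edges a)

  edgeCount : length (edges a') ≡ suc m
  edgeCount = Eq.trans (cong length eqE') (Eq.trans (length-++-sucʳ E₁ c E₂) (cong suc (cong length (sym eqE))))

  reaches : ∀ {θ : List Bool} → length θ ≡ m → k ≤ length θ
  reaches l = ≤-trans (length-++-≤ˡ E₁) (≤-reflexive (Eq.trans (cong length (sym eqE)) (sym l)))

  -- New edge ascending: one more ascent, and it acts as a strict edge for hrv.
  term-insert-true : ∀ {θ} → length θ ≡ m →
    term a' s (insertAt k true θ) ≡ timesQTerm (term a (c ∷ s) θ)
  term-insert-true {θ} l =
    cong₂ _,_ (asc-insert-true k θ) (partitionOf-↭ a a' (c ∷ s) s θ (insertAt k true θ) lenA directedEdges)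
    where
    open PermutationReasoning
    directedEdges : s ++ ascEdges (edges a') (insertAt k true θ) ↭ (c ∷ s) ++ ascEdges (edges a) θ
    directedEdges = begin
      s ++ ascEdges (edges a') (insertAt k true θ)
        ≡⟨ cong (λ E → s ++ ascEdges E (insertAt k true θ)) eqE' ⟩
      s ++ ascEdges (E₁ ++ c ∷ E₂) (insertAt k true θ)
        ↭⟨ ++⁺ˡ s (ascEdges-insert-true E₁ E₂ c θ (reaches {θ} l)) ⟩
      s ++ c ∷ ascEdges (E₁ ++ E₂) θ
        ↭⟨ shift c s _ ⟩
      c ∷ s ++ ascEdges (E₁ ++ E₂) θ
        ≡⟨ cong (λ E → c ∷ s ++ ascEdges E θ) (sym eqE) ⟩
      (c ∷ s) ++ ascEdges (edges a) θ
        ∎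

  term-insert-false : ∀ {θ} → length θ ≡ m → term a' s (insertAt k false θ) ≡ term a s θ
  term-insert-false {θ} l =
    cong₂ _,_ (asc-insert-false k θ) (partitionOf-↭ a a' s s θ (insertAt k false θ) lenA (↭-reflexive directedEdges))
    where
    open ≡-Reasoning
    directedEdges : s ++ ascEdges (edges a') (insertAt k false θ) ≡ s ++ ascEdges (edges a) θ
    directedEdges = begin
      s ++ ascEdges (edges a') (insertAt k false θ)
        ≡⟨ cong (λ E → s ++ ascEdges E (insertAt k false θ)) eqE' ⟩
      s ++ ascEdges (E₁ ++ c ∷ E₂) (insertAt k false θ)
        ≡⟨ cong (s ++_) (ascEdges-insert-false E₁ E₂ c θ (reaches {θ} l)) ⟩
      s ++ ascEdges (E₁ ++ E₂) θ
        ≡⟨ cong (λ E → s ++ ascEdges E θ) (sym eqE) ⟩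
      s ++ ascEdges (edges a) θ
        ∎

  L-insert : L a' s ↭ timesQ (L a (c ∷ s)) ++ L a s
  L-insert = begin
    map (term a' s) (allBools (length (edges a')))
      ≡⟨ cong (map (term a' s) ∘ allBools) edgeCount ⟩
    map (term a' s) (allBools (suc m))
      ↭⟨ map⁺ (term a' s) (allBools-insertAt k m) ⟩
    map (term a' s) (map (insertAt k true) X ++ map (insertAt k false) X)
      ≡⟨ map-++ (term a' s) (map (insertAt k true) X) (map (insertAt k false) X) ⟩
    map (term a' s) (map (insertAt k true) X) ++ map (term a' s) (map (insertAt k false) X)
      ≡⟨ cong₂ _++_ ascendingNew descendingNew ⟩
    timesQ (L a (c ∷ s)) ++ L a s
      ∎
    where
    open PermutationReasoning
    X = allBools m
    ascendingNew : map (term a' s) (map (insertAt k true) X) ≡ timesQ (L a (c ∷ s))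
    ascendingNew = Eq.trans (sym (map-∘ X))
      (Eq.trans (map-cong-local (All.map term-insert-true (allBools-length m))) (map-∘ X))
    descendingNew : map (term a' s) (map (insertAt k false) X) ≡ L a s
    descendingNew = Eq.trans (sym (map-∘ X)) (map-cong-local (All.map term-insert-false (allBools-length m)))

proposition4p2 : (a a' : List ℕ) (s : List (ℕ × ℕ)) (u v : ℕ) →
    IsAreaSeq a → All (IsOuterCorner a) s → Unique s →
    IsOuterCorner a (u , v) → (u , v) ∉ s →
    IsAreaSeq a' → length a' ≡ length a →
    (∀ j i → Edge a' j i ⇔ (Edge a j i ⊎ (j ≡ u × i ≡ v))) →
    L a' s ↭ (timesQ (L a ((u , v) ∷ s)) ++ L a s)
proposition4p2 a a' s u v _ _ _ corner _ _ lenA iff with edges-insert a a' lenA corner iff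
... | E₁ , E₂ , eqE , eqE' = EdgeInsertion.L-insert a a' s (u , v) E₁ E₂ lenA eqE eqE'
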